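{- Let $b\ge 1$ be an integer and let $L_{1,b}=\{C_{1,1},C_{2,1}\}\cup\{C_{1,j}:1<j\le b+1\}$, an $L$-shaped polyomino of size $n=b+2$. Then on the $n\times n$ board, $2\le \mathrm{cp}_{\mathrm{free}}(L_{1,b})\le 4$.
   Context: A cell $C_{i,j}$ ($i,j$ integers) is the closed unit square in column $i$ and row $j$ of the integer grid. A polyomino is a finite set of cells; its size is its number of cells. For a polyomino $\mathcal P$ of size $n$, the board is $\mathbb B=\{C_{i,j}:1\le i,j\le n\}$. A shift of $\mathcal P$ by an integer pair $(c,d)$ is $\{C_{x+c,y+d}:C_{x,y}\in\mathcal P\}$. Two polyominoes are free equivalent if one is obtained from the other by a rotation of the grid by an integer multiple of $90^\circ$ followed by a shift (reflections are not allowed). A set of polyominoes is a valid arrangement if all lie in $\mathbb B$ and they are pairwise disjoint. A free packing of $\mathcal P$ is a valid arrangement of polyominoes free equivalent to $\mathcal P$ such that adding any further polyomino free equivalent to $\mathcal P$ yields an invalid arrangement. The clumsy free packing number $\mathrm{cp}_{\mathrm{free}}(\mathcal P)$ is the minimum number of polyominoes in a free packing of $\mathcal P$ on the $n\times n$ board, $n=|\mathcal P|$. -}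

module Defs where

open import Data.Nat using (ℕ; zero; suc) renaming (_+_ to _+ℕ_)
open import Data.Integer using (ℤ; +_; -_; _+_; _≤_)
open import Data.Product using (Σ; _×_; _,_)
open import Data.List using (List; []; _∷_; map; upTo)
open import Data.List.Membership.Propositional using (_∈_)
open import Data.List.Relation.Unary.All using (All)
open import Data.List.Relation.Unary.Any using (Any)
open import Data.List.Relation.Unary.AllPairs using (AllPairs)
open import Relation.Nullary using (¬_)

-- A cell C_{i,j} is identified with its index pair (i , j) ∈ ℤ × ℤ.
Cell : Set
Cell = ℤ × ℤ

-- A polyomino (finite set of cells) is represented by a list of cells,
-- read as the set of its members.
Polyomino : Set
Polyomino = List Cell

rot : Cell → Cell
rot (x , y) = (- y , x)

rotN : ℕ → Cell → Cell
rotN zero    z = z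
rotN (suc k) z = rot (rotN k z)

shift : ℤ → ℤ → Cell → Cell
shift c d (x , y) = (x + c , y + d)

FreeEquiv : Polyomino → Polyomino → Set
FreeEquiv P Q = Σ ℕ λ k → Σ ℤ λ c → Σ ℤ λ d →
  ((z : Cell) → z ∈ Q → z ∈ map (λ w → shift c d (rotN k w)) P) ×
  ((z : Cell) → z ∈ map (λ w → shift c d (rotN k w)) P → z ∈ Q)

InBoardCell : ℕ → Cell → Set
InBoardCell n (i , j) = ((+ 1 ≤ i) × (i ≤ + n)) × ((+ 1 ≤ j) × (j ≤ + n))

InBoard : ℕ → Polyomino → Set
InBoard n Q = All (InBoardCell n) Q

Disjoint : Polyomino → Polyomino → Set
Disjoint Q R = (z : Cell) → z ∈ Q → ¬ (z ∈ R)

FreePacking : ℕ → Polyomino → List Polyomino → Set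
FreePacking n P A =
  All (FreeEquiv P) A × All (InBoard n) A × AllPairs Disjoint A ×
  ((Q : Polyomino) → FreeEquiv P Q → InBoard n Q → Any (λ R → ¬ Disjoint R Q) A)

L1 : ℕ → Polyomino
L1 b = (+ 1 , + 1) ∷ (+ 2 , + 1) ∷ map (λ j → (+ 1 , + (j +ℕ 2))) (upTo b)

{-# OPTIONS --safe #-}
-- A copy of L1 b fitting the board of side n = b + 2 is one of four orientations of a
-- stem of length n − 1 with a foot, in a 2 × (n − 1) box placed in one of 2(b + 1) ways.
-- Lower bound: the four hooks, each with its stem along one side of the board and its foot
-- on the next side, lie on two adjacent sides; a single placement keeps off one vertical
-- and one horizontal side, so it misses one hook, which can still be added.
-- Upper bound: for b ≥ 2 the pinwheel of four stems along the four sides is disjoint and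
-- covers the boundary, while every stem, being only one shorter than the side, reaches
-- the boundary; for b = 1 two trominoes already block the 3 × 3 board.
module Submission where

open import Defs
open import Data.Nat using (ℕ; zero; suc; z≤n; s≤s; _+_; _∸_; _≤_; _<_; _<?_)
open import Data.Nat.Properties
open import Data.Integer using (ℤ; +_; -_; -[1+_]; +≤+)
import Data.Integer as ℤ
import Data.Integer.Properties as ℤₚ
open import Data.Product using (Σ; _×_; _,_; proj₁; proj₂)
open import Data.Product.Properties using (≡-dec)
open import Data.Sum using (_⊎_; inj₁; inj₂)
open import Data.Empty using (⊥; ⊥-elim)
open import Data.List using (List; []; _∷_; map; upTo; length; cartesianProduct)
open import Data.List.Membership.Propositional using (_∈_; lose)
open import Data.List.Membership.Propositional.Properties
  using (∈-map⁺; ∈-map⁻; ∈-upTo⁺; ∈-upTo⁻; ∈-cartesianProduct⁺)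
import Data.List.Membership.DecPropositional as DecMembership
open import Data.List.Properties using (map-cong)
open import Data.List.Relation.Unary.Any using (Any; here; there; any?)
import Data.List.Relation.Unary.Any as Any
open import Data.List.Relation.Unary.All using (All; []; _∷_; all?)
open import Data.List.Relation.Unary.All.Properties using (map⁺)
import Data.List.Relation.Unary.All as All
open import Data.List.Relation.Unary.AllPairs using (AllPairs; []; _∷_)
open import Data.List.Relation.Binary.Subset.Propositional using (_⊆_)
open import Relation.Nullary using (¬_; Dec; yes; no; ¬?)
open import Relation.Nullary.Decidable using (toWitness)
open import Relation.Binary.PropositionalEquality

-- Placements

-- Orientations are named after the direction of the stem (the long leg) seen from the
-- corner.  The placement "b o a t" has a 2 × (b+1) bounding box whose lower-left cell is
-- offset by a across the stem and by t along it; it fits the board iff a ≤ b and t ≤ 1.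
data Orientation : Set where
  north west south east : Orientation

quarterTurns : Orientation → ℕ
quarterTurns north = 0
quarterTurns west  = 1
quarterTurns south = 2
quarterTurns east  = 3

offsetX offsetY : ℕ → Orientation → ℕ → ℕ → ℤ
offsetX b north a t = + a
offsetX b west  a t = + suc (suc (t + b))
offsetX b south a t = + suc (suc (suc a))
offsetX b east  a t = + t
offsetY b north a t = + t
offsetY b west  a t = + a
offsetY b south a t = + suc (suc (t + b))
offsetY b east  a t = + suc (suc (suc a))

move : ℕ → Orientation → ℕ → ℕ → Cell → Cell
move b o a t w = shift (offsetX b o a t) (offsetY b o a t) (rotN (quarterTurns o) w)

placed : ℕ → Orientation → ℕ → ℕ → Polyomino
placed b o a t = map (move b o a t) (L1 b)

toCell : ℕ × ℕ → Cell
toCell (x , y) = (+ x , + y)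

toCell-injective : ∀ {p q} → toCell p ≡ toCell q → p ≡ q
toCell-injective {_ , _} {_ , _} eq =
  cong₂ _,_ (ℤₚ.+-injective (cong proj₁ eq)) (ℤₚ.+-injective (cong proj₂ eq))

stemCell : Orientation → ℕ → ℕ → ℕ × ℕ
stemCell north a s = (suc a , s)
stemCell west  a s = (s , suc a)
stemCell south a s = (suc (suc a) , s)
stemCell east  a s = (s , suc (suc a))

footCell : ℕ → Orientation → ℕ → ℕ → ℕ × ℕ
footCell b north a t = (suc (suc a) , suc t)
footCell b west  a t = (suc (t + b) , suc (suc a))
footCell b south a t = (suc a , suc (t + b))
footCell b east  a t = (suc t , suc a)

cornerPos : ℕ → Orientation → ℕ → ℕ
cornerPos b north t = suc t
cornerPos b west  t = suc (t + b)
cornerPos b south t = suc (t + b)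
cornerPos b east  t = suc t

-- position along the stem of the image of the cell (1 , j + 2) of L1 b
stemPos : ℕ → Orientation → ℕ → ℕ → ℕ
stemPos b north t j = (j + 2) + t
stemPos b west  t j = (t + b) ∸ j
stemPos b south t j = (t + b) ∸ j
stemPos b east  t j = (j + 2) + t

move-corner : ∀ b o a t → move b o a t (+ 1 , + 1) ≡ toCell (stemCell o a (cornerPos b o t))
move-corner b north a t = refl
move-corner b west  a t = refl
move-corner b south a t = refl
move-corner b east  a t = refl

move-foot : ∀ b o a t → move b o a t (+ 2 , + 1) ≡ toCell (footCell b o a t)
move-foot b north a t = refl
move-foot b west  a t = refl
move-foot b south a t = refl
move-foot b east  a t = refl

-[j+2]+[m+2]≡m∸j : ∀ j m → j ≤ m → - (+ (j + 2)) ℤ.+ + suc (suc m) ≡ + (m ∸ j)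
-[j+2]+[m+2]≡m∸j j m j≤m rewrite +-comm j 2 = ℤₚ.⊖-≥ (s≤s (s≤s j≤m))

move-stem : ∀ b o a t j → j ≤ t + b →
            move b o a t (+ 1 , + (j + 2)) ≡ toCell (stemCell o a (stemPos b o t j))
move-stem b north a t j _   = refl
move-stem b west  a t j j≤ = cong (_, + suc a) (-[j+2]+[m+2]≡m∸j j (t + b) j≤)
move-stem b south a t j j≤ = cong (+ suc (suc a) ,_) (-[j+2]+[m+2]≡m∸j j (t + b) j≤)
move-stem b east  a t j _   =
  cong (λ x → (x ℤ.+ + t , + suc (suc a))) (ℤₚ.neg-involutive (+ (j + 2)))

∈-map-L1⁻ : ∀ b (f : Cell → Cell) {z} → z ∈ map f (L1 b) →
            z ≡ f (+ 1 , + 1) ⊎ z ≡ f (+ 2 , + 1) ⊎ Σ ℕ λ j → j < b × z ≡ f (+ 1 , + (j + 2))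
∈-map-L1⁻ b f (here eq)         = inj₁ eq
∈-map-L1⁻ b f (there (here eq)) = inj₂ (inj₁ eq)
∈-map-L1⁻ b f (there (there z∈)) with ∈-map⁻ f z∈
... | _ , w∈ , refl with ∈-map⁻ (λ j → (+ 1 , + (j + 2))) w∈
...   | j , j∈ , refl = inj₂ (inj₂ (j , ∈-upTo⁻ j∈ , refl))

stem∈-map-L1 : ∀ b (f : Cell → Cell) {j} → j < b → f (+ 1 , + (j + 2)) ∈ map f (L1 b)
stem∈-map-L1 b f j<b = there (there (∈-map⁺ f (∈-map⁺ (λ j → (+ 1 , + (j + 2))) (∈-upTo⁺ j<b))))

Between : ℕ → ℕ → ℕ → Set
Between lo hi v = lo ≤ v × v ≤ hi

StemRange : ℕ → ℕ → ℕ → Set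
StemRange b t = Between (suc t) (suc (t + b))

Across : ℕ → ℕ → Set
Across a = Between (suc a) (suc (suc a))

ascending-range : ∀ b t {j} → j < b → StemRange b t ((j + 2) + t)
ascending-range b t {j} j<b rewrite +-comm j 2 =
  s≤s (≤-trans (m≤n+m t j) (n≤1+n _)) , s≤s (≤-trans (+-monoˡ-≤ t j<b) (≤-reflexive (+-comm b t)))

descending-range : ∀ b t {j} → j < b → StemRange b t ((t + b) ∸ j)
descending-range b t {j} j<b =
  m+n≤o⇒m≤o∸n (suc t) (≤-trans (≤-reflexive (sym (+-suc t j))) (+-monoʳ-≤ t j<b)) ,
  ≤-trans (m∸n≤m (t + b) j) (n≤1+n _)

ascending-onto : ∀ b t {s} → StemRange b t s → s ≡ suc t ⊎ Σ ℕ λ j → j < b × (j + 2) + t ≡ s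
ascending-onto b t {suc s} (s≤s t≤s , s≤) with m≤n⇒m<n∨m≡n t≤s
... | inj₂ refl = inj₁ refl
... | inj₁ (s≤s {n = s′} t≤s′) = inj₂ (s′ ∸ t , j<b , eq)
  where
  j+t≡s′ : s′ ∸ t + t ≡ s′
  j+t≡s′ = m∸n+n≡m t≤s′
  eq : (s′ ∸ t + 2) + t ≡ suc (suc s′)
  eq rewrite +-comm (s′ ∸ t) 2 = cong (λ u → suc (suc u)) j+t≡s′
  j<b : s′ ∸ t < b
  j<b = +-cancelʳ-≤ t (suc (s′ ∸ t)) b
          (≤-trans (≤-reflexive (cong suc j+t≡s′)) (≤-trans (≤-pred s≤) (≤-reflexive (+-comm t b))))

descending-onto : ∀ b t {s} → StemRange b t s → s ≡ suc (t + b) ⊎ Σ ℕ λ j → j < b × (t + b) ∸ j ≡ s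
descending-onto b t {s} (t<s , s≤) with m≤n⇒m<n∨m≡n s≤
... | inj₂ refl = inj₁ refl
... | inj₁ (s≤s s≤t+b) = inj₂ (t + b ∸ s , j<b , m∸[m∸n]≡n s≤t+b)
  where
  j<b : t + b ∸ s < b
  j<b = +-cancelˡ-≤ t (suc (t + b ∸ s)) b (begin
    t + suc (t + b ∸ s) ≡⟨ +-suc t _ ⟩
    suc t + (t + b ∸ s) ≤⟨ +-monoˡ-≤ _ t<s ⟩
    s + (t + b ∸ s)     ≡⟨ m+[n∸m]≡n s≤t+b ⟩
    t + b               ∎)
    where open ≤-Reasoning

cornerPos-range : ∀ b o t → StemRange b t (cornerPos b o t)
cornerPos-range b north t = ≤-refl , s≤s (m≤m+n t b)
cornerPos-range b west  t = s≤s (m≤m+n t b) , ≤-refl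
cornerPos-range b south t = s≤s (m≤m+n t b) , ≤-refl
cornerPos-range b east  t = ≤-refl , s≤s (m≤m+n t b)

stemPos-range : ∀ b o t {j} → j < b → StemRange b t (stemPos b o t j)
stemPos-range b north t = ascending-range b t
stemPos-range b west  t = descending-range b t
stemPos-range b south t = descending-range b t
stemPos-range b east  t = ascending-range b t

stemPos-onto : ∀ b o t {s} → StemRange b t s →
               s ≡ cornerPos b o t ⊎ Σ ℕ λ j → j < b × stemPos b o t j ≡ s
stemPos-onto b north t = ascending-onto b t
stemPos-onto b west  t = descending-onto b t
stemPos-onto b south t = descending-onto b t
stemPos-onto b east  t = ascending-onto b t

data OnPiece (b : ℕ) (o : Orientation) (a t : ℕ) : ℕ × ℕ → Set where
  stem : ∀ {s} → StemRange b t s → OnPiece b o a t (stemCell o a s)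
  foot : OnPiece b o a t (footCell b o a t)

AllCells : (ℕ × ℕ → Set) → Polyomino → Set
AllCells P R = ∀ {z} → z ∈ R → Σ (ℕ × ℕ) λ p → z ≡ toCell p × P p

allCells-mono : ∀ {P P′ : ℕ × ℕ → Set} {R} → (∀ {p} → P p → P′ p) → AllCells P R → AllCells P′ R
allCells-mono P⇒P′ cellsR z∈ with cellsR z∈
... | p , eq , Pp = p , eq , P⇒P′ Pp

allCells-⊆ : ∀ {P R S} → R ⊆ S → AllCells P S → AllCells P R
allCells-⊆ R⊆S cellsS z∈ = cellsS (R⊆S z∈)

separated⇒disjoint : ∀ {P P′ : ℕ × ℕ → Set} {R R′} → AllCells P R → AllCells P′ R′ →
                     (∀ {p} → P p → P′ p → ⊥) → Disjoint R R′
separated⇒disjoint {P′ = P′} cellsR cellsR′ separated z z∈R z∈R′ with cellsR z∈R | cellsR′ z∈R′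
... | p , refl , Pp | q , eq , P′q = separated Pp (subst P′ (toCell-injective (sym eq)) P′q)

placed-cells : ∀ b o a t → AllCells (OnPiece b o a t) (placed b o a t)
placed-cells b o a t z∈ with ∈-map-L1⁻ b (move b o a t) z∈
... | inj₁ eq = _ , trans eq (move-corner b o a t) , stem (cornerPos-range b o t)
... | inj₂ (inj₁ eq) = _ , trans eq (move-foot b o a t) , foot
... | inj₂ (inj₂ (j , j<b , eq)) =
  _ , trans eq (move-stem b o a t j (≤-trans (<⇒≤ j<b) (m≤n+m b t))) , stem (stemPos-range b o t j<b)

stem∈placed : ∀ b o a t {s} → StemRange b t s → toCell (stemCell o a s) ∈ placed b o a t
stem∈placed b o a t r with stemPos-onto b o t r
... | inj₁ refl = subst (_∈ placed b o a t) (move-corner b o a t) (here refl)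
... | inj₂ (j , j<b , refl) =
  subst (_∈ placed b o a t) (move-stem b o a t j (≤-trans (<⇒≤ j<b) (m≤n+m b t)))
        (stem∈-map-L1 b (move b o a t) j<b)

BoundingBox : ℕ → Orientation → ℕ → ℕ → ℕ × ℕ → Set
BoundingBox b north a t (x , y) = Across a x × StemRange b t y
BoundingBox b south a t (x , y) = Across a x × StemRange b t y
BoundingBox b west  a t (x , y) = StemRange b t x × Across a y
BoundingBox b east  a t (x , y) = StemRange b t x × Across a y

onPiece⇒boundingBox : ∀ {b} o {a t p} → OnPiece b o a t p → BoundingBox b o a t p
onPiece⇒boundingBox north (stem r) = (≤-refl , n≤1+n _) , r
onPiece⇒boundingBox west  (stem r) = r , (≤-refl , n≤1+n _)
onPiece⇒boundingBox south (stem r) = (n≤1+n _ , ≤-refl) , r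
onPiece⇒boundingBox east  (stem r) = r , (n≤1+n _ , ≤-refl)
onPiece⇒boundingBox {b} north {t = t} foot = (n≤1+n _ , ≤-refl) , (≤-refl , s≤s (m≤m+n t b))
onPiece⇒boundingBox {b} west  {t = t} foot = (s≤s (m≤m+n t b) , ≤-refl) , (n≤1+n _ , ≤-refl)
onPiece⇒boundingBox {b} south {t = t} foot = (≤-refl , n≤1+n _) , (s≤s (m≤m+n t b) , ≤-refl)
onPiece⇒boundingBox {b} east  {t = t} foot = (≤-refl , s≤s (m≤m+n t b)) , (≤-refl , n≤1+n _)

InSquare : ℕ → ℕ × ℕ → Set
InSquare n (x , y) = Between 1 n x × Between 1 n y

inSquare⇒inBoardCell : ∀ {n} p → InSquare n p → InBoardCell n (toCell p)
inSquare⇒inBoardCell _ ((1≤x , x≤n) , (1≤y , y≤n)) = (+≤+ 1≤x , +≤+ x≤n) , (+≤+ 1≤y , +≤+ y≤n)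

across-bounded : ∀ {a b x} → a ≤ b → Across a x → Between 1 (suc (suc b)) x
across-bounded a≤b (lo , hi) = ≤-trans (s≤s z≤n) lo , ≤-trans hi (s≤s (s≤s a≤b))

stemRange-bounded : ∀ {b t y} → t ≤ 1 → StemRange b t y → Between 1 (suc (suc b)) y
stemRange-bounded {b} t≤1 (lo , hi) = ≤-trans (s≤s z≤n) lo , ≤-trans hi (s≤s (+-monoˡ-≤ b t≤1))

record Placement (b : ℕ) : Set where
  constructor placement
  field
    orientation : Orientation
    across along : ℕ
    across≤b : across ≤ b
    along≤1 : along ≤ 1

  cells : Polyomino
  cells = placed b orientation across along

  Shape : ℕ × ℕ → Set
  Shape = OnPiece b orientation across along

  Box : ℕ × ℕ → Set
  Box = BoundingBox b orientation across along

  cells-shape : AllCells Shape cells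
  cells-shape = placed-cells b orientation across along

  cells-inBox : AllCells Box cells
  cells-inBox = allCells-mono (onPiece⇒boundingBox orientation) cells-shape

  box⇒inSquare : ∀ p → Box p → InSquare (suc (suc b)) p
  box⇒inSquare = go orientation
    where
    go : ∀ o p → BoundingBox b o across along p → InSquare (suc (suc b)) p
    go north _ (x∈ , y∈) = across-bounded across≤b x∈ , stemRange-bounded along≤1 y∈
    go south _ (x∈ , y∈) = across-bounded across≤b x∈ , stemRange-bounded along≤1 y∈
    go west  _ (x∈ , y∈) = stemRange-bounded along≤1 x∈ , across-bounded across≤b y∈
    go east  _ (x∈ , y∈) = stemRange-bounded along≤1 x∈ , across-bounded across≤b y∈

  cells-inBoard : InBoard (suc (suc b)) cells
  cells-inBoard = All.tabulate λ z∈ → inBoard (cells-inBox z∈)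
    where
    inBoard : ∀ {z} → Σ (ℕ × ℕ) (λ p → z ≡ toCell p × Box p) → InBoardCell (suc (suc b)) z
    inBoard (p , refl , box) = inSquare⇒inBoardCell p (box⇒inSquare p box)

  cells-freeEquiv : FreeEquiv (L1 b) cells
  cells-freeEquiv =
    quarterTurns orientation , offsetX b orientation across along , offsetY b orientation across along ,
    (λ _ z∈ → z∈) , (λ _ z∈ → z∈)

open Placement using (cells; cells-shape; cells-inBox; cells-inBoard; cells-freeEquiv)

-- Normal form of fitting copies

rot⁴≡id : ∀ z → rot (rot (rot (rot z))) ≡ z
rot⁴≡id (x , y) = cong₂ _,_ (ℤₚ.neg-involutive x) (ℤₚ.neg-involutive y)

rotN≡quarterTurns : ∀ k → Σ Orientation λ o → ∀ z → rotN k z ≡ rotN (quarterTurns o) z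
rotN≡quarterTurns zero                   = north , λ _ → refl
rotN≡quarterTurns (suc zero)             = west  , λ _ → refl
rotN≡quarterTurns (suc (suc zero))       = south , λ _ → refl
rotN≡quarterTurns (suc (suc (suc zero))) = east  , λ _ → refl
rotN≡quarterTurns (suc (suc (suc (suc k)))) with rotN≡quarterTurns k
... | o , eq = o , λ z → trans (rot⁴≡id (rotN k z)) (eq z)

turned : ℕ → ℕ → ℤ → ℤ → Polyomino
turned b k c d = map (λ w → shift c d (rotN k w)) (L1 b)

NormalOffset : ℕ → Orientation → ℤ → ℤ → Set
NormalOffset b o c d =
  Σ ℕ λ a → Σ ℕ λ t → a ≤ b × t ≤ 1 × c ≡ offsetX b o a t × d ≡ offsetY b o a t

1≤1+c⇒natural : ∀ c → + 1 ℤ.≤ + 1 ℤ.+ c → Σ ℕ λ m → c ≡ + m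
1≤1+c⇒natural (+ m)            _          = m , refl
1≤1+c⇒natural -[1+ zero ]      (+≤+ ())
1≤1+c⇒natural -[1+ suc _ ]     ()

1≤c-1⇒natural≥2 : ∀ c → + 1 ℤ.≤ -[1+ 0 ] ℤ.+ c → Σ ℕ λ m → c ≡ + suc (suc m)
1≤c-1⇒natural≥2 (+ zero)          ()
1≤c-1⇒natural≥2 (+ suc zero)      (+≤+ ())
1≤c-1⇒natural≥2 (+ suc (suc m))   _ = m , refl
1≤c-1⇒natural≥2 -[1+ _ ]          ()

1≤[m+2]-[j+2]⇒j<m : ∀ j m → + 1 ℤ.≤ - (+ (j + 2)) ℤ.+ + suc (suc m) → j < m
1≤[m+2]-[j+2]⇒j<m j m le with j <? m
... | yes j<m = j<m
... | no j≮m = ⊥-elim (1≰-n (j ∸ m) (subst (+ 1 ℤ.≤_) eq le))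
  where
  eq : - (+ (j + 2)) ℤ.+ + suc (suc m) ≡ - (+ (j ∸ m))
  eq rewrite +-comm j 2 = ℤₚ.⊖-≤ (s≤s (s≤s (≮⇒≥ j≮m)))
  1≰-n : ∀ n → ¬ (+ 1 ℤ.≤ - (+ n))
  1≰-n zero (+≤+ ())
  1≰-n (suc n) ()

tip-inBoard⇒t≤1 : ∀ b t → (b + 2) + t ≤ suc (suc (suc b)) → t ≤ 1
tip-inBoard⇒t≤1 b t le rewrite +-comm b 2 =
  +-cancelˡ-≤ b t 1 (≤-trans (≤-pred (≤-pred le)) (≤-reflexive (+-comm 1 b)))

m≤n≤1+m⇒n≡t+m : ∀ {B C} → B ≤ C → C ≤ suc B → Σ ℕ λ t → t ≤ 1 × C ≡ t + B
m≤n≤1+m⇒n≡t+m {B} {C} lo hi =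
  C ∸ B , ≤-trans (∸-monoˡ-≤ B hi) (≤-reflexive (m+n∸n≡m 1 B)) , sym (m∸n+n≡m lo)

-- The corner, the foot and the tip of the stem staying inside the board pin the offset
-- down to the normal form; for south and east the across offset a is read off the
-- lower bound on the foot.
fitting-offset-normal : ∀ b o c d → InBoard (suc (suc (suc b))) (turned (suc b) (quarterTurns o) c d) →
                        NormalOffset (suc b) o c d
fitting-offset-normal b north c d fits
  with All.lookup fits (here refl)
... | (lo₁ , _) , (lo₂ , _) with 1≤1+c⇒natural c lo₁ | 1≤1+c⇒natural d lo₂
... | a , refl | t , refl
  with All.lookup fits (there (here refl)) | All.lookup fits (stem∈-map-L1 (suc b) _ ≤-refl)
... | (_ , +≤+ foot≤) , _ | _ , (_ , +≤+ tip≤) =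
  a , t , ≤-pred (≤-pred foot≤) , tip-inBoard⇒t≤1 b t tip≤ , refl , refl
fitting-offset-normal b west c d fits
  with All.lookup fits (here refl)
... | (lo₁ , _) , (lo₂ , _) with 1≤c-1⇒natural≥2 c lo₁ | 1≤1+c⇒natural d lo₂
... | C , refl | a , refl
  with All.lookup fits (here refl) | All.lookup fits (there (here refl))
     | All.lookup fits (stem∈-map-L1 (suc b) _ ≤-refl)
... | (_ , +≤+ corner≤) , _ | _ , (_ , +≤+ foot≤) | (tip≥ , _) , _
  with m≤n≤1+m⇒n≡t+m (1≤[m+2]-[j+2]⇒j<m b C tip≥) (≤-pred corner≤)
... | t , t≤1 , refl = a , t , ≤-pred (≤-pred foot≤) , t≤1 , refl , refl
fitting-offset-normal b south c d fits
  with All.lookup fits (here refl)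
... | (lo₁ , _) , (lo₂ , _) with 1≤c-1⇒natural≥2 c lo₁ | 1≤c-1⇒natural≥2 d lo₂
... | C , refl | D , refl with All.lookup fits (there (here refl))
... | (+≤+ (s≤s {n = a} _) , _) , _
  with All.lookup fits (here refl) | All.lookup fits (stem∈-map-L1 (suc b) _ ≤-refl)
... | (_ , +≤+ corner≤) , (_ , +≤+ cornerY≤) | _ , (tip≥ , _)
  with m≤n≤1+m⇒n≡t+m (1≤[m+2]-[j+2]⇒j<m b D tip≥) (≤-pred cornerY≤)
... | t , t≤1 , refl = a , t , ≤-pred (≤-pred corner≤) , t≤1 , refl , refl
fitting-offset-normal b east c d fits
  with All.lookup fits (here refl)
... | (lo₁ , _) , (lo₂ , _) with 1≤1+c⇒natural c lo₁ | 1≤c-1⇒natural≥2 d lo₂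
... | t , refl | D , refl with All.lookup fits (there (here refl))
... | _ , (+≤+ (s≤s {n = a} _) , _)
  with All.lookup fits (here refl) | All.lookup fits (stem∈-map-L1 (suc b) _ ≤-refl)
... | _ , (_ , +≤+ corner≤) | (_ , tip≤) , _ =
  a , t , ≤-pred (≤-pred corner≤) , tip-inBoard⇒t≤1 b t tip≤′ , refl , refl
  where
  tip≤′ : (b + 2) + t ≤ suc (suc (suc b))
  tip≤′ with subst (λ x → x ℤ.+ + t ℤ.≤ + suc (suc (suc b))) (ℤₚ.neg-involutive (+ (b + 2))) tip≤
  ... | +≤+ le = le

turned-cong : ∀ b c d {k l} → (∀ z → rotN k z ≡ rotN l z) → turned b k c d ≡ turned b l c d
turned-cong b c d rotN≡ = map-cong (λ w → cong (shift c d) (rotN≡ w)) (L1 b)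

inBoard⇒placement : ∀ b → 1 ≤ b → ∀ Q → FreeEquiv (L1 b) Q → InBoard (suc (suc b)) Q →
                    Σ (Placement b) λ P → Q ⊆ cells P × cells P ⊆ Q
inBoard⇒placement (suc b) _ Q (k , c , d , Q⊆ , ⊆Q) inBoard
  with o , rotN≡ ← rotN≡quarterTurns k
  with eq ← turned-cong (suc b) c d rotN≡
  with a , t , a≤b , t≤1 , refl , refl ← fitting-offset-normal b o c d
         (All.tabulate λ {z} z∈ → All.lookup inBoard (⊆Q z (subst (z ∈_) (sym eq) z∈)))
  = placement o a t a≤b t≤1
  , (λ {z} z∈ → subst (z ∈_) eq (Q⊆ z z∈))
  , (λ {z} z∈ → ⊆Q z (subst (z ∈_) (sym eq) z∈))

-- The lower bound

data Edge : Set where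
  low high : Edge

edgeLine : ℕ → Edge → ℕ
edgeLine n low  = 1
edgeLine n high = n

OnEdges : ℕ → Edge → Edge → ℕ × ℕ → Set
OnEdges n ex ey (x , y) = x ≡ edgeLine n ex ⊎ y ≡ edgeLine n ey

hook : ∀ b → Edge → Edge → Placement b
hook b low  low  = placement north 0 0 z≤n z≤n
hook b high low  = placement west  0 1 z≤n ≤-refl
hook b high high = placement south b 1 ≤-refl ≤-refl
hook b low  high = placement east  b 0 ≤-refl z≤n

hook-onEdges : ∀ b ex ey → AllCells (OnEdges (suc (suc b)) ex ey) (cells (hook b ex ey))
hook-onEdges b ex ey = allCells-mono (onEdges ex ey) (cells-shape (hook b ex ey))
  where
  onEdges : ∀ ex ey {p} → Placement.Shape (hook b ex ey) p → OnEdges (suc (suc b)) ex ey p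
  onEdges low  low  (stem _) = inj₁ refl
  onEdges low  low  foot     = inj₂ refl
  onEdges high low  (stem _) = inj₂ refl
  onEdges high low  foot     = inj₁ refl
  onEdges high high (stem _) = inj₁ refl
  onEdges high high foot     = inj₂ refl
  onEdges low  high (stem _) = inj₂ refl
  onEdges low  high foot     = inj₁ refl

across-avoids : ∀ {b} a → 1 ≤ b → Σ Edge λ e → ∀ {x} → Across a x → x ≢ edgeLine (suc (suc b)) e
across-avoids zero    (s≤s _) = high , λ { (_ , s≤s (s≤s ())) refl }
across-avoids (suc a) _       = low  , λ { (s≤s () , _) refl }

stemRange-avoids : ∀ b {t} → t ≤ 1 → Σ Edge λ e → ∀ {y} → StemRange b t y → y ≢ edgeLine (suc (suc b)) e
stemRange-avoids b z≤n       = high , λ { (_ , y≤) refl → n≮n (suc b) y≤ }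
stemRange-avoids b (s≤s z≤n) = low  , λ { (s≤s () , _) refl }

placement-avoids : ∀ {b} → 1 ≤ b → (P : Placement b) →
                   Σ Edge λ ex → Σ Edge λ ey → ∀ {p} → Placement.Box P p → ¬ OnEdges (suc (suc b)) ex ey p
placement-avoids {b} 1≤b (placement o a t _ t≤1)
  with ex , x∉ ← across-avoids a 1≤b | ey , y∉ ← stemRange-avoids b t≤1 = go o
  where
  go : ∀ o → Σ Edge λ ex → Σ Edge λ ey → ∀ {p} → BoundingBox b o a t p → ¬ OnEdges (suc (suc b)) ex ey p
  go north = ex , ey , λ { (x∈ , _) (inj₁ eq) → x∉ x∈ eq ; (_ , y∈) (inj₂ eq) → y∉ y∈ eq }
  go south = ex , ey , λ { (x∈ , _) (inj₁ eq) → x∉ x∈ eq ; (_ , y∈) (inj₂ eq) → y∉ y∈ eq }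
  go west  = ey , ex , λ { (x∈ , _) (inj₁ eq) → y∉ x∈ eq ; (_ , y∈) (inj₂ eq) → x∉ y∈ eq }
  go east  = ey , ex , λ { (x∈ , _) (inj₁ eq) → y∉ x∈ eq ; (_ , y∈) (inj₂ eq) → x∉ y∈ eq }

freePacking-maximal : ∀ {b A} → FreePacking (suc (suc b)) (L1 b) A →
                      (P : Placement b) → Any (λ R → ¬ Disjoint R (cells P)) A
freePacking-maximal (_ , _ , _ , maximal) P = maximal (cells P) (cells-freeEquiv P) (cells-inBoard P)

packing-length≥2 : ∀ b → 1 ≤ b → ∀ A → FreePacking (suc (suc b)) (L1 b) A → 2 ≤ length A
packing-length≥2 b _ [] packing with freePacking-maximal packing (hook b low low)
... | ()
packing-length≥2 b 1≤b (R ∷ []) packing@(R~L ∷ [] , R∈ ∷ [] , _)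
  with P , R⊆P , _ ← inBoard⇒placement b 1≤b R R~L R∈
  with ex , ey , avoids ← placement-avoids 1≤b P
  with freePacking-maximal packing (hook b ex ey)
... | here ¬disjoint =
  ⊥-elim (¬disjoint (separated⇒disjoint (allCells-⊆ R⊆P (cells-inBox P)) (hook-onEdges b ex ey) avoids))
packing-length≥2 _ _ (_ ∷ _ ∷ _) _ = s≤s (s≤s z≤n)

-- The upper bound

Meets : Polyomino → Polyomino → Set
Meets R S = Any (_∈ S) R

meets⇒¬disjoint : ∀ {R S Q} → Meets R S → S ⊆ Q → ¬ Disjoint R Q
meets⇒¬disjoint (here z∈S)  S⊆Q disjoint = disjoint _ (here refl) (S⊆Q z∈S)
meets⇒¬disjoint (there R∩S) S⊆Q disjoint = meets⇒¬disjoint R∩S S⊆Q (λ z z∈R → disjoint z (there z∈R))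

MeetsEveryPlacement : ∀ b → List (Placement b) → Set
MeetsEveryPlacement b A = (P : Placement b) → Any (λ R → Meets R (cells P)) (map cells A)

placements-freePacking : ∀ b → 1 ≤ b → (A : List (Placement b)) → AllPairs Disjoint (map cells A) →
                         MeetsEveryPlacement b A → FreePacking (suc (suc b)) (L1 b) (map cells A)
placements-freePacking b 1≤b A disjoint meetsAll =
  map⁺ (All.universal cells-freeEquiv A) , map⁺ (All.universal cells-inBoard A) , disjoint , maximal
  where
  maximal : ∀ Q → FreeEquiv (L1 b) Q → InBoard (suc (suc b)) Q → Any (λ R → ¬ Disjoint R Q) (map cells A)
  maximal Q Q~L Q∈ with P , _ , P⊆Q ← inBoard⇒placement b 1≤b Q Q~L Q∈ =
    Any.map (λ meets → meets⇒¬disjoint {S = cells P} meets P⊆Q) (meetsAll P)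

orientations : List Orientation
orientations = north ∷ west ∷ south ∷ east ∷ []

∈-orientations : ∀ o → o ∈ orientations
∈-orientations north = here refl
∈-orientations west  = there (here refl)
∈-orientations south = there (there (here refl))
∈-orientations east  = there (there (there (here refl)))

open DecMembership (≡-dec ℤ._≟_ ℤ._≟_) using (_∈?_)

smallPacking : List (Placement 1)
smallPacking = placement west 0 0 z≤n z≤n ∷ placement south 1 1 ≤-refl ≤-refl ∷ []

smallPacking-disjoint : AllPairs Disjoint (map cells smallPacking)
smallPacking-disjoint = (disjoint ∷ []) ∷ [] ∷ []
  where
  disjoint : Disjoint (placed 1 west 0 0) (placed 1 south 1 1)
  disjoint z z∈ = All.lookup allOutside z∈
    where
    allOutside : All (λ z → ¬ z ∈ placed 1 south 1 1) (placed 1 west 0 0)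
    allOutside = toWitness {a? = all? (λ z → ¬? (z ∈? placed 1 south 1 1)) _} _

-- On the 3 × 3 board there are only 16 placements; each is checked by computation.
smallPacking-meetsEveryPlacement : MeetsEveryPlacement 1 smallPacking
smallPacking-meetsEveryPlacement (placement o a t a≤1 t≤1) =
  All.lookup meetsAll (∈-cartesianProduct⁺ (∈-orientations o)
                        (∈-cartesianProduct⁺ (∈-upTo⁺ (s≤s a≤1)) (∈-upTo⁺ (s≤s t≤1))))
  where
  Met : Orientation × ℕ × ℕ → Set
  Met (o , a , t) = Any (λ R → Meets R (placed 1 o a t)) (map cells smallPacking)
  met? : ∀ q → Dec (Met q)
  met? (o , a , t) = any? (λ R → any? (_∈? placed 1 o a t) R) (map cells smallPacking)
  meetsAll : All Met (cartesianProduct orientations (cartesianProduct (upTo 2) (upTo 2)))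
  meetsAll = toWitness {a? = all? met? _} _

data OnBoundary (n : ℕ) : ℕ × ℕ → Set where
  left   : ∀ {y} → OnBoundary n (1 , y)
  right  : ∀ {y} → OnBoundary n (n , y)
  bottom : ∀ {x} → OnBoundary n (x , 1)
  top    : ∀ {x} → OnBoundary n (x , n)

stemRange-reaches-edge : ∀ b {t} → t ≤ 1 → Σ ℕ λ s → StemRange b t s × (s ≡ 1 ⊎ s ≡ suc (suc b))
stemRange-reaches-edge b z≤n       = 1 , (s≤s z≤n , s≤s z≤n) , inj₁ refl
stemRange-reaches-edge b (s≤s z≤n) = suc (suc b) , (s≤s (s≤s z≤n) , ≤-refl) , inj₂ refl

stemCell-onBoundary : ∀ o a {n s} → s ≡ 1 ⊎ s ≡ n → OnBoundary n (stemCell o a s)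
stemCell-onBoundary north a (inj₁ refl) = bottom
stemCell-onBoundary north a (inj₂ refl) = top
stemCell-onBoundary south a (inj₁ refl) = bottom
stemCell-onBoundary south a (inj₂ refl) = top
stemCell-onBoundary west  a (inj₁ refl) = left
stemCell-onBoundary west  a (inj₂ refl) = right
stemCell-onBoundary east  a (inj₁ refl) = left
stemCell-onBoundary east  a (inj₂ refl) = right

placement-boundaryCell : ∀ {b} (P : Placement b) →
  Σ (ℕ × ℕ) λ p → toCell p ∈ cells P × InSquare (suc (suc b)) p × OnBoundary (suc (suc b)) p
placement-boundaryCell {b} P@(placement o a t _ t≤1)
  with s , s∈ , s-edge ← stemRange-reaches-edge b t≤1 =
  stemCell o a s , stem∈placed b o a t s∈ ,
  Placement.box⇒inSquare P _ (onPiece⇒boundingBox o (stem s∈)) , stemCell-onBoundary o a s-edge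

pinwheel : ∀ b → List (Placement b)
pinwheel b = placement north 0 1 z≤n ≤-refl ∷ placement south b 0 ≤-refl z≤n
           ∷ placement east b 1 ≤-refl ≤-refl ∷ placement west 0 0 z≤n z≤n ∷ []

pinwheel-covers-boundary : ∀ b {p} → InSquare (suc (suc b)) p → OnBoundary (suc (suc b)) p →
                           Any (toCell p ∈_) (map cells (pinwheel b))
pinwheel-covers-boundary b _ (left {1}) =
  there (there (there (here (stem∈placed b west 0 0 (s≤s z≤n , s≤s z≤n)))))
pinwheel-covers-boundary b (_ , (_ , y≤)) (left {suc (suc y)}) =
  here (stem∈placed b north 0 1 (s≤s (s≤s z≤n) , y≤))
pinwheel-covers-boundary b (_ , (1≤y , y≤)) right with m≤n⇒m<n∨m≡n y≤
... | inj₁ (s≤s y≤b+1) = there (here (stem∈placed b south b 0 (1≤y , y≤b+1)))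
... | inj₂ refl        = there (there (here (stem∈placed b east b 1 (s≤s (s≤s z≤n) , ≤-refl))))
pinwheel-covers-boundary b ((1≤x , x≤) , _) bottom with m≤n⇒m<n∨m≡n x≤
... | inj₁ (s≤s x≤b+1) = there (there (there (here (stem∈placed b west 0 0 (1≤x , x≤b+1)))))
... | inj₂ refl        = there (here (stem∈placed b south b 0 (s≤s z≤n , s≤s z≤n)))
pinwheel-covers-boundary b _ (top {1}) = here (stem∈placed b north 0 1 (s≤s (s≤s z≤n) , ≤-refl))
pinwheel-covers-boundary b ((_ , x≤) , _) (top {suc (suc x)}) =
  there (there (here (stem∈placed b east b 1 (s≤s (s≤s z≤n) , x≤))))

pinwheel-meetsEveryPlacement : ∀ b → MeetsEveryPlacement b (pinwheel b)
pinwheel-meetsEveryPlacement b P with p , p∈P , p∈square , p∈boundary ← placement-boundaryCell P =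
  Any.map (λ p∈R → lose p∈R p∈P) (pinwheel-covers-boundary b p∈square p∈boundary)

stemRange-1-absurd : ∀ {b} → ¬ StemRange b 1 1
stemRange-1-absurd (s≤s () , _)

stemRange-top-absurd : ∀ {b} → ¬ StemRange b 0 (suc (suc b))
stemRange-top-absurd {b} (_ , top≤) = n≮n (suc b) top≤

pinwheel-disjoint : ∀ m → AllPairs Disjoint (map cells (pinwheel (suc (suc m))))
pinwheel-disjoint m =
  (apart north∦south ∷ apart north∦east ∷ apart north∦west ∷ []) ∷
  (apart south∦east ∷ apart south∦west ∷ []) ∷ (apart east∦west ∷ []) ∷ [] ∷ []
  where
  b : ℕ
  b = suc (suc m)
  apart : ∀ {o a t o′ a′ t′} → (∀ {p} → OnPiece b o a t p → OnPiece b o′ a′ t′ p → ⊥) →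
          Disjoint (placed b o a t) (placed b o′ a′ t′)
  apart = separated⇒disjoint (placed-cells _ _ _ _) (placed-cells _ _ _ _)
  -- most coincidences are refuted by unification, using b ≥ 2
  north∦south : ∀ {p} → OnPiece b north 0 1 p → OnPiece b south b 0 p → ⊥
  north∦south (stem _) ()
  north∦south foot ()
  north∦east : ∀ {p} → OnPiece b north 0 1 p → OnPiece b east b 1 p → ⊥
  north∦east (stem _) (stem r) = stemRange-1-absurd r
  north∦east foot ()
  north∦west : ∀ {p} → OnPiece b north 0 1 p → OnPiece b west 0 0 p → ⊥
  north∦west (stem r) (stem _) = stemRange-1-absurd r
  north∦west foot ()
  south∦east : ∀ {p} → OnPiece b south b 0 p → OnPiece b east b 1 p → ⊥
  south∦east (stem r) (stem _) = stemRange-top-absurd r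
  south∦east foot ()
  south∦west : ∀ {p} → OnPiece b south b 0 p → OnPiece b west 0 0 p → ⊥
  south∦west (stem _) (stem r) = stemRange-top-absurd r
  south∦west foot ()
  east∦west : ∀ {p} → OnPiece b east b 1 p → OnPiece b west 0 0 p → ⊥
  east∦west (stem _) ()
  east∦west foot ()

packing-length≤4 : ∀ b → 1 ≤ b →
                   Σ (List Polyomino) λ A → FreePacking (suc (suc b)) (L1 b) A × length A ≤ 4
packing-length≤4 1 1≤b =
  map cells smallPacking ,
  placements-freePacking 1 1≤b smallPacking smallPacking-disjoint smallPacking-meetsEveryPlacement ,
  s≤s (s≤s z≤n)
packing-length≤4 b@(suc (suc m)) 1≤b =
  map cells (pinwheel b) ,
  placements-freePacking b 1≤b (pinwheel b) (pinwheel-disjoint m) (pinwheel-meetsEveryPlacement b) ,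
  ≤-refl

corollary3p12 : (b : ℕ) → 1 ≤ b →
    (Σ (List Polyomino) λ A → FreePacking (b + 2) (L1 b) A × length A ≤ 4) ×
    ((A : List Polyomino) → FreePacking (b + 2) (L1 b) A → 2 ≤ length A)
corollary3p12 b 1≤b rewrite +-comm b 2 = packing-length≤4 b 1≤b , packing-length≥2 b 1≤b
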